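{- Let $n\ge 2$. In $G(n)$ there are two (distinct) directed edges from a vertex $\mathbf a$ to a vertex $\mathbf b$ if and only if $\mathbf a=a_1a_2\cdots a_n$ and $\mathbf b=\sigma(\mathbf a)=a_2a_3\cdots a_na_1$.
   Context: For a sequence of distinct integers $c_1\cdots c_t$, $\mathrm{st}(c_1\cdots c_t)$ is the unique permutation $d_1\cdots d_t$ of $\{1,\dots,t\}$ with $d_i<d_j$ iff $c_i<c_j$. $G(n)$ is the directed multigraph whose vertices are the permutations of $\{1,\dots,n\}$ (one-line notation) and whose edges are the permutations $c_1\cdots c_{n+1}$ of $\{1,\dots,n+1\}$, the edge $c_1\cdots c_{n+1}$ going from $\mathrm{st}(c_1\cdots c_n)$ to $\mathrm{st}(c_2\cdots c_{n+1})$. The cyclic shift of $\mathbf a=a_1\cdots a_n$ is $\sigma(\mathbf a)=a_2a_3\cdots a_na_1$. -}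

module Defs where

open import Data.Nat using (ℕ; suc; _≤_; _<_)
open import Data.Fin using (Fin)
open import Data.Vec using (Vec; []; _∷_; _∷ʳ_; lookup; init; tail)
open import Data.Product using (_×_; Σ; _,_)
open import Relation.Binary.PropositionalEquality using (_≡_)
open import Relation.Nullary using (¬_)
open import Function.Bundles using (_⇔_)

IsPerm : {n : ℕ} → Vec ℕ n → Set
IsPerm {n} v =
  ((i : Fin n) → (1 ≤ lookup v i × lookup v i ≤ n)) ×
  ((i j : Fin n) → lookup v i ≡ lookup v j → i ≡ j)

-- d = st(c): d is a permutation of {1,…,t} with d_i < d_j iff c_i < c_j.
-- (For a sequence c of distinct integers this d exists and is unique.)
IsSt : {t : ℕ} → Vec ℕ t → Vec ℕ t → Set
IsSt {t} c d = IsPerm d × ((i j : Fin t) → (lookup d i < lookup d j) ⇔ (lookup c i < lookup c j))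

-- c (a permutation of {1,…,n+1}) is an edge of G(n) from a to b:
-- st(c_1⋯c_n) = a and st(c_2⋯c_{n+1}) = b.
IsEdge : {n : ℕ} → Vec ℕ (suc n) → Vec ℕ n → Vec ℕ n → Set
IsEdge c a b = IsPerm c × IsSt (init c) a × IsSt (tail c) b

σ : {n : ℕ} → Vec ℕ n → Vec ℕ n
σ [] = []
σ (x ∷ xs) = xs ∷ʳ x

TwoEdges : {n : ℕ} → Vec ℕ n → Vec ℕ n → Set
TwoEdges {n} a b =
  Σ (Vec ℕ (suc n)) λ c → Σ (Vec ℕ (suc n)) λ c' →
    IsEdge c a b × IsEdge c' a b × ¬ (c ≡ c')

-- An edge c from a to b fixes, through a = st(c₁⋯cₙ) and b = st(c₂⋯cₙ₊₁), every
-- comparison between entries of c except c₁ versus cₙ₊₁; as a permutation is determined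
-- by its order pattern, there is at most one edge for each outcome of that comparison.
-- If both outcomes occur, no entry of c lies strictly between c₁ and cₙ₊₁, so replacing
-- cₙ₊₁ by c₁ does not change the pattern of c₂⋯cₙ₊₁: b = st(c₂⋯cₙc₁) = σ(a).
-- Conversely, for b = σ(a) the two edges are f(a₁)⋯f(aₙ)θ for θ = a₁ and θ = a₁ + 1,
-- where f shifts the values ≥ θ up by one.
module Submission where

open import Defs
open import Data.Empty using (⊥-elim)
open import Data.Fin using (Fin; zero; suc; fromℕ; fromℕ<; inject₁)
open import Data.Fin.Properties using (any?; fromℕ<-injective; fromℕ≢inject₁; injective⇒≤; suc-injective; 0≢1+n)
open import Data.Fin.Relation.Unary.Top using (view; ‵fromℕ; ‵inject₁)
open import Data.Nat using (ℕ; zero; suc; _≤_; _<_; _<?_; _≟_; z≤n; s≤s)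
open import Data.Nat.Properties
  using (<-cmp; <-irrefl; <-asym; <-trans; ≤-<-trans; <-≤-trans; <⇒≢; m≤n⇒m≤1+n; ≤-pred; ≤-antisym; ≤-trans; ≤-refl; 1+n≰n; n≤1+n; ≮⇒≥; ≤∧≢⇒<)
open import Data.Product using (_×_; _,_; proj₁; proj₂; ∃)
open import Data.Vec using (Vec; []; _∷_; lookup; init; map)
open import Data.Vec.Properties using (lookup-map; init-∷ʳ; ∷ʳ-injectiveʳ)
open import Data.Vec.Relation.Binary.Pointwise.Extensional using (ext; Pointwise-≡⇒≡)
open import Function using (_∘_)
open import Function.Bundles using (_⇔_; mk⇔; Equivalence)
import Function.Properties.Equivalence as ⇔
open import Relation.Binary.Core using (_Preserves_⟶_)
open import Relation.Binary.Definitions using (tri<; tri≈; tri>)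
open import Relation.Binary.PropositionalEquality
  using (_≡_; _≢_; _≗_; refl; sym; trans; cong; subst; subst₂)
open import Relation.Nullary using (¬_; yes; no)

variable
  k n : ℕ

<-cong-⇔ : {x x′ y y′ : ℕ} → x ≡ x′ → y ≡ y′ → (x < y) ⇔ (x′ < y′)
<-cong-⇔ refl refl = ⇔.refl

<-irrefl-⇔ : {x y : ℕ} → (x < x) ⇔ (y < y)
<-irrefl-⇔ = mk⇔ (⊥-elim ∘ <-irrefl refl) (⊥-elim ∘ <-irrefl refl)

-- Same order pattern; IsSt c d unfolds to IsPerm d × lookup d ≅ lookup c.
infix 4 _≅_

_≅_ : (Fin k → ℕ) → (Fin k → ℕ) → Set
u ≅ v = ∀ i j → (u i < u j) ⇔ (v i < v j)

≅-sym : {u v : Fin k → ℕ} → u ≅ v → v ≅ u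
≅-sym p i j = ⇔.sym (p i j)

≅-trans : {u v w : Fin k → ℕ} → u ≅ v → v ≅ w → u ≅ w
≅-trans p q i j = ⇔.trans (p i j) (q i j)

≅-resp-≗ : {u u′ v v′ : Fin k → ℕ} → u ≗ u′ → v ≗ v′ → u ≅ v → u′ ≅ v′
≅-resp-≗ eu ev p i j =
  ⇔.trans (<-cong-⇔ (sym (eu i)) (sym (eu j))) (⇔.trans (p i j) (<-cong-⇔ (ev i) (ev j)))

strictMono⇒∘-≅ : {f : ℕ → ℕ} → f Preserves _<_ ⟶ _<_ → (u : Fin k → ℕ) → (f ∘ u) ≅ u
strictMono⇒∘-≅ {f = f} f-mono u i j = mk⇔ reflects f-mono
  where
  reflects : f (u i) < f (u j) → u i < u j
  reflects fu<fu with <-cmp (u i) (u j)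
  ... | tri< lt _ _ = lt
  ... | tri≈ _ eq _ = ⊥-elim (<-irrefl (cong f eq) fu<fu)
  ... | tri> _ _ gt = ⊥-elim (<-asym fu<fu (f-mono gt))

≅-by-head : {u v : Fin (suc k) → ℕ} → (u ∘ suc) ≅ (v ∘ suc) →
            (∀ j → (u (suc j) < u zero) ⇔ (v (suc j) < v zero)) →
            (∀ j → (u zero < u (suc j)) ⇔ (v zero < v (suc j))) →
            u ≅ v
≅-by-head p below above zero    zero    = <-irrefl-⇔
≅-by-head p below above zero    (suc j) = above j
≅-by-head p below above (suc i) zero    = below i
≅-by-head p below above (suc i) (suc j) = p i j

≅-by-last : {u v : Fin (suc k) → ℕ} → (u ∘ inject₁) ≅ (v ∘ inject₁) →
            (∀ j → (u (inject₁ j) < u (fromℕ k)) ⇔ (v (inject₁ j) < v (fromℕ k))) →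
            (∀ j → (u (fromℕ k) < u (inject₁ j)) ⇔ (v (fromℕ k) < v (inject₁ j))) →
            u ≅ v
≅-by-last p below above i j with view i | view j
... | ‵fromℕ     | ‵fromℕ     = <-irrefl-⇔
... | ‵fromℕ     | ‵inject₁ j = above j
... | ‵inject₁ i | ‵fromℕ     = below i
... | ‵inject₁ i | ‵inject₁ j = p i j

private
  index : ∀ {x} → 1 ≤ x → x ≤ n → Fin n
  index {x = suc x} _ x<n = fromℕ< x<n

  index-injective : ∀ {x y} (1≤x : 1 ≤ x) (x≤n : x ≤ n) (1≤y : 1 ≤ y) (y≤n : y ≤ n) →
                    index 1≤x x≤n ≡ index 1≤y y≤n → x ≡ y
  index-injective {x = suc x} {suc y} _ x<n _ y<n eq = cong suc (fromℕ<-injective x y x<n y<n eq)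

-- A missing value would give an injection Fin (suc n) → Fin n.
IsPerm-surjective : {v : Vec ℕ n} → IsPerm v → ∀ {x} → 1 ≤ x → x ≤ n → ∃ λ i → lookup v i ≡ x
IsPerm-surjective {n} {v} (range , inj) {x} 1≤x x≤n with any? (λ i → lookup v i ≟ x)
... | yes hit = hit
... | no miss = ⊥-elim (1+n≰n (injective⇒≤ g-injective))
  where
  g : Fin (suc n) → Fin n
  g zero    = index 1≤x x≤n
  g (suc i) = index (proj₁ (range i)) (proj₂ (range i))

  g-injective : ∀ {i j} → g i ≡ g j → i ≡ j
  g-injective {zero}  {zero}  _  = refl
  g-injective {zero}  {suc j} eq = ⊥-elim (miss (j , sym (index-injective _ _ _ _ eq)))
  g-injective {suc i} {zero}  eq = ⊥-elim (miss (i , index-injective _ _ _ _ eq))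
  g-injective {suc i} {suc j} eq = cong suc (inj i j (index-injective _ _ _ _ eq))

-- Induction on the value x = uᵢ: the position holding x − 1 lies below i in u, hence in v.
IsPerm-≤ : {u v : Vec ℕ n} → IsPerm u → IsPerm v →
           (∀ i j → lookup u i < lookup u j → lookup v i < lookup v j) →
           ∀ i → lookup u i ≤ lookup v i
IsPerm-≤ {n} {u} {v} pu pv mono i = go (lookup u i) i refl
  where
  go : ∀ x i → lookup u i ≡ x → x ≤ lookup v i
  go zero          i _    = z≤n
  go (suc zero)    i _    = proj₁ (proj₁ pv i)
  go (suc (suc x)) i ui≡x =
    let j , uj≡x = IsPerm-surjective {v = u} pu (s≤s z≤n)
                     (≤-trans (n≤1+n _) (subst (_≤ n) ui≡x (proj₂ (proj₁ pu i))))
    in ≤-<-trans (go (suc x) j uj≡x) (mono j i (subst₂ _<_ (sym uj≡x) (sym ui≡x) ≤-refl))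

IsPerm-≅⇒≡ : {u v : Vec ℕ n} → IsPerm u → IsPerm v → lookup u ≅ lookup v → u ≡ v
IsPerm-≅⇒≡ {u = u} {v} pu pv p = Pointwise-≡⇒≡ (ext λ i →
  ≤-antisym (IsPerm-≤ {u = u} {v} pu pv (λ i j → Equivalence.to (p i j)) i)
            (IsPerm-≤ {u = v} {u} pv pu (λ i j → Equivalence.from (p i j)) i))

lookup-σ-inject₁ : (v : Vec ℕ (suc n)) (j : Fin n) → lookup (σ v) (inject₁ j) ≡ lookup v (suc j)
lookup-σ-inject₁ (x ∷ y ∷ ys) zero    = refl
lookup-σ-inject₁ (x ∷ y ∷ ys) (suc j) = lookup-σ-inject₁ (x ∷ ys) j

lookup-σ-fromℕ : (v : Vec ℕ (suc n)) → lookup (σ v) (fromℕ n) ≡ lookup v zero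
lookup-σ-fromℕ (x ∷ [])     = refl
lookup-σ-fromℕ (x ∷ y ∷ ys) = lookup-σ-fromℕ (x ∷ ys)

IsPerm-σ : {v : Vec ℕ (suc n)} → IsPerm v → IsPerm (σ v)
IsPerm-σ {n} {v} (range , inj) = range-σ , inj-σ
  where
  range-σ : ∀ i → 1 ≤ lookup (σ v) i × lookup (σ v) i ≤ suc n
  range-σ i with view i
  ... | ‵fromℕ     = subst (λ x → 1 ≤ x × x ≤ suc n) (sym (lookup-σ-fromℕ v)) (range zero)
  ... | ‵inject₁ j = subst (λ x → 1 ≤ x × x ≤ suc n) (sym (lookup-σ-inject₁ v j)) (range (suc j))

  inj-σ : ∀ i j → lookup (σ v) i ≡ lookup (σ v) j → i ≡ j
  inj-σ i j eq with view i | view j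
  ... | ‵fromℕ     | ‵fromℕ     = refl
  ... | ‵fromℕ     | ‵inject₁ j = ⊥-elim (0≢1+n (inj zero (suc j)
        (trans (sym (lookup-σ-fromℕ v)) (trans eq (lookup-σ-inject₁ v j)))))
  ... | ‵inject₁ i | ‵fromℕ     = ⊥-elim (0≢1+n (inj zero (suc i)
        (trans (sym (lookup-σ-fromℕ v)) (trans (sym eq) (lookup-σ-inject₁ v i)))))
  ... | ‵inject₁ i | ‵inject₁ j = cong inject₁ (suc-injective (inj (suc i) (suc j)
        (trans (sym (lookup-σ-inject₁ v i)) (trans eq (lookup-σ-inject₁ v j)))))

≅-σ-intro : {u : Fin (suc n) → ℕ} (w : Vec ℕ (suc n)) →
      (u ∘ inject₁) ≅ (lookup w ∘ suc) →
      (∀ j → (u (inject₁ j) < u (fromℕ n)) ⇔ (lookup w (suc j) < lookup w zero)) →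
      (∀ j → (u (fromℕ n) < u (inject₁ j)) ⇔ (lookup w zero < lookup w (suc j))) →
      u ≅ lookup (σ w)
≅-σ-intro w p below above = ≅-by-last
  (≅-resp-≗ (λ _ → refl) (sym ∘ lookup-σ-inject₁ w) p)
  (λ j → ⇔.trans (below j) (<-cong-⇔ (sym (lookup-σ-inject₁ w j)) (sym (lookup-σ-fromℕ w))))
  (λ j → ⇔.trans (above j) (<-cong-⇔ (sym (lookup-σ-fromℕ w)) (sym (lookup-σ-inject₁ w j))))

σ-cong-≅ : {v w : Vec ℕ (suc n)} → lookup v ≅ lookup w → lookup (σ v) ≅ lookup (σ w)
σ-cong-≅ {v = v} {w} p = ≅-σ-intro w
  (≅-resp-≗ (sym ∘ lookup-σ-inject₁ v) (λ _ → refl) (λ i j → p (suc i) (suc j)))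
  (λ j → ⇔.trans (<-cong-⇔ (lookup-σ-inject₁ v j) (lookup-σ-fromℕ v)) (p (suc j) zero))
  (λ j → ⇔.trans (<-cong-⇔ (lookup-σ-fromℕ v) (lookup-σ-inject₁ v j)) (p zero (suc j)))

lookup-init : (v : Vec ℕ (suc n)) (i : Fin n) → lookup (init v) i ≡ lookup v (inject₁ i)
lookup-init (x ∷ y ∷ ys) zero    = refl
lookup-init (x ∷ y ∷ ys) (suc i) = lookup-init (y ∷ ys) i

<-flip-⇔ : {x y x′ y′ : ℕ} → x ≢ y → x′ ≢ y′ → (x < y) ⇔ (x′ < y′) → (y < x) ⇔ (y′ < x′)
<-flip-⇔ x≢y x′≢y′ p = mk⇔ (flip x≢y x′≢y′ (Equivalence.from p)) (flip x′≢y′ x≢y (Equivalence.to p))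
  where
  flip : ∀ {x y x′ y′} → x ≢ y → x′ ≢ y′ → (x′ < y′ → x < y) → y < x → y′ < x′
  flip x≢y x′≢y′ back y<x = ≤∧≢⇒< (≮⇒≥ (λ x′<y′ → <-asym y<x (back x′<y′))) (x′≢y′ ∘ sym)

not-between⇒same-side : {x y z : ℕ} → x < y → ¬ (x < z × z < y) → z ≢ x → z ≢ y →
                        ((z < x) ⇔ (z < y)) × ((x < z) ⇔ (y < z))
not-between⇒same-side {x} {y} {z} x<y gap z≢x z≢y =
  mk⇔ (λ z<x → <-trans z<x x<y) below , mk⇔ above (λ y<z → <-trans x<y y<z)
  where
  below : z < y → z < x
  below z<y with <-cmp z x
  ... | tri< z<x _ _ = z<x
  ... | tri≈ _ z≡x _ = ⊥-elim (z≢x z≡x)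
  ... | tri> _ _ x<z = ⊥-elim (gap (x<z , z<y))
  above : x < z → y < z
  above x<z with <-cmp z y
  ... | tri< z<y _ _ = ⊥-elim (gap (x<z , z<y))
  ... | tri≈ _ z≡y _ = ⊥-elim (z≢y z≡y)
  ... | tri> _ _ y<z = y<z

first final : Vec ℕ (suc (suc n)) → ℕ
first c = lookup c zero
final {n} c = lookup c (fromℕ (suc n))

middle : Vec ℕ (suc (suc n)) → Fin n → ℕ
middle c j = lookup c (suc (inject₁ j))

Rising : Vec ℕ (suc (suc n)) → Set
Rising c = first c < final c

first≢final : (c : Vec ℕ (suc (suc n))) → IsPerm c → first c ≢ final c
first≢final {n} c (_ , inj) eq = 0≢1+n (inj zero (fromℕ (suc n)) eq)

¬Rising⇒falling : (c : Vec ℕ (suc (suc n))) → IsPerm c → ¬ Rising c → final c < first c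
¬Rising⇒falling c pc ¬rising = ≤∧≢⇒< (≮⇒≥ ¬rising) (first≢final c pc ∘ sym)

module _ {a b : Vec ℕ (suc n)} where

  edge-init-≅ : (c : Vec ℕ (suc (suc n))) → IsEdge c a b → lookup a ≅ (lookup c ∘ inject₁)
  edge-init-≅ c (_ , (_ , p) , _) = ≅-resp-≗ (λ _ → refl) (lookup-init c) p

  edge-tail-≅ : (c : Vec ℕ (suc (suc n))) → IsEdge c a b → lookup b ≅ (lookup c ∘ suc)
  edge-tail-≅ (x ∷ xs) (_ , _ , (_ , p)) = p

  edges-init-≅ : (c c′ : Vec ℕ (suc (suc n))) → IsEdge c a b → IsEdge c′ a b →
                 (lookup c ∘ inject₁) ≅ (lookup c′ ∘ inject₁)
  edges-init-≅ c c′ e e′ = ≅-trans (≅-sym (edge-init-≅ c e)) (edge-init-≅ c′ e′)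

  edges-tail-≅ : (c c′ : Vec ℕ (suc (suc n))) → IsEdge c a b → IsEdge c′ a b →
                 (lookup c ∘ suc) ≅ (lookup c′ ∘ suc)
  edges-tail-≅ c c′ e e′ = ≅-trans (≅-sym (edge-tail-≅ c e)) (edge-tail-≅ c′ e′)

  -- Two edges from a to b agree on every comparison except possibly first versus final.
  same-direction⇒≡ : (c c′ : Vec ℕ (suc (suc n))) → IsEdge c a b → IsEdge c′ a b →
                     Rising c ⇔ Rising c′ → c ≡ c′
  same-direction⇒≡ c c′ e e′ rising =
    IsPerm-≅⇒≡ {u = c} {c′} (proj₁ e) (proj₁ e′) (≅-by-last (edges-init-≅ c c′ e e′) below above)
    where
    below : ∀ j → (lookup c (inject₁ j) < final c) ⇔ (lookup c′ (inject₁ j) < final c′)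
    below zero    = rising
    below (suc j) = edges-tail-≅ c c′ e e′ (inject₁ j) (fromℕ n)
    above : ∀ j → (final c < lookup c (inject₁ j)) ⇔ (final c′ < lookup c′ (inject₁ j))
    above zero    = <-flip-⇔ (first≢final c (proj₁ e)) (first≢final c′ (proj₁ e′)) rising
    above (suc j) = edges-tail-≅ c c′ e e′ (fromℕ n) (inject₁ j)

  opposite-edges⇒not-between : (c c′ : Vec ℕ (suc (suc n))) → IsEdge c a b → IsEdge c′ a b →
    final c′ < first c′ → ∀ j → ¬ (first c < middle c j × middle c j < final c)
  opposite-edges⇒not-between c c′ e e′ falling′ j (first<middle , middle<final) =
    <-asym falling′ (<-trans (Equivalence.to (edges-init-≅ c c′ e e′ zero (suc j)) first<middle)
                             (Equivalence.to (edges-tail-≅ c c′ e e′ (inject₁ j) (fromℕ n)) middle<final))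

  opposite-edges⇒σ : (c c′ : Vec ℕ (suc (suc n))) → IsEdge c a b → IsEdge c′ a b →
                     Rising c → final c′ < first c′ → b ≡ σ a
  opposite-edges⇒σ c c′ e@(pc , (pa , _) , (pb , _)) e′ rising falling′ =
    IsPerm-≅⇒≡ {u = b} {σ a} pb (IsPerm-σ {v = a} pa) (≅-σ-intro a inner below above)
    where
    init-c : lookup a ≅ (lookup c ∘ inject₁)
    init-c = edge-init-≅ c e
    tail-c : lookup b ≅ (lookup c ∘ suc)
    tail-c = edge-tail-≅ c e
    same-side : ∀ j → ((middle c j < first c) ⇔ (middle c j < final c)) ×
                      ((first c < middle c j) ⇔ (final c < middle c j))
    same-side j = not-between⇒same-side rising (opposite-edges⇒not-between c c′ e e′ falling′ j)
      (λ eq → 0≢1+n (proj₂ pc zero _ (sym eq)))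
      (λ eq → fromℕ≢inject₁ (sym (suc-injective (proj₂ pc _ (fromℕ (suc n)) eq))))
    inner : (lookup b ∘ inject₁) ≅ (lookup a ∘ suc)
    inner i j = ⇔.trans (tail-c (inject₁ i) (inject₁ j)) (⇔.sym (init-c (suc i) (suc j)))
    below : ∀ j → (lookup b (inject₁ j) < lookup b (fromℕ n)) ⇔ (lookup a (suc j) < lookup a zero)
    below j = ⇔.trans (tail-c (inject₁ j) (fromℕ n))
                (⇔.trans (⇔.sym (proj₁ (same-side j))) (⇔.sym (init-c (suc j) zero)))
    above : ∀ j → (lookup b (fromℕ n) < lookup b (inject₁ j)) ⇔ (lookup a zero < lookup a (suc j))
    above j = ⇔.trans (tail-c (fromℕ n) (inject₁ j))
                (⇔.trans (⇔.sym (proj₂ (same-side j))) (⇔.sym (init-c zero (suc j))))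

  two-edges⇒σ : TwoEdges a b → b ≡ σ a
  two-edges⇒σ (c , c′ , e , e′ , c≢c′) with first c <? final c | first c′ <? final c′
  ... | yes r  | yes r′  = ⊥-elim (c≢c′ (same-direction⇒≡ c c′ e e′ (mk⇔ (λ _ → r′) (λ _ → r))))
  ... | no ¬r  | no ¬r′  = ⊥-elim (c≢c′ (same-direction⇒≡ c c′ e e′ (mk⇔ (⊥-elim ∘ ¬r) (⊥-elim ∘ ¬r′))))
  ... | yes r  | no ¬r′  = opposite-edges⇒σ c c′ e e′ r (¬Rising⇒falling c′ (proj₁ e′) ¬r′)
  ... | no ¬r  | yes r′  = opposite-edges⇒σ c′ c e′ e r′ (¬Rising⇒falling c (proj₁ e) ¬r)

punchInℕ : ℕ → ℕ → ℕ
punchInℕ θ y with y <? θ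
... | yes _ = y
... | no  _ = suc y

punchInℕ-mono : (θ : ℕ) → punchInℕ θ Preserves _<_ ⟶ _<_
punchInℕ-mono θ {y} {z} y<z with y <? θ | z <? θ
... | yes _   | yes _   = y<z
... | yes _   | no  _   = m≤n⇒m≤1+n y<z
... | no  y≮θ | yes z<θ = ⊥-elim (y≮θ (<-trans y<z z<θ))
... | no  _   | no  _   = s≤s y<z

punchInℕ-injective : (θ : ℕ) → ∀ {y z} → punchInℕ θ y ≡ punchInℕ θ z → y ≡ z
punchInℕ-injective θ {y} {z} eq with <-cmp y z
... | tri< y<z _ _ = ⊥-elim (<⇒≢ (punchInℕ-mono θ y<z) eq)
... | tri≈ _ y≡z _ = y≡z
... | tri> _ _ z<y = ⊥-elim (<⇒≢ (punchInℕ-mono θ z<y) (sym eq))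

punchInℕ-≢ : (θ y : ℕ) → punchInℕ θ y ≢ θ
punchInℕ-≢ θ y eq with y <? θ
... | yes y<θ = <-irrefl eq y<θ
... | no  y≮θ = y≮θ (subst (y <_) eq ≤-refl)

punchInℕ-range : (θ : ℕ) → ∀ {y} → 1 ≤ y × y ≤ n → 1 ≤ punchInℕ θ y × punchInℕ θ y ≤ suc n
punchInℕ-range θ {y} (1≤y , y≤n) with y <? θ
... | yes _ = 1≤y , m≤n⇒m≤1+n y≤n
... | no  _ = s≤s z≤n , s≤s y≤n

punchInℕ-same-side : ∀ {θ x y} → x ≤ θ → θ ≤ suc x → y ≢ x →
                     ((y < x) ⇔ (punchInℕ θ y < θ)) × ((x < y) ⇔ (θ < punchInℕ θ y))
punchInℕ-same-side {θ} {x} {y} x≤θ θ≤1+x y≢x with y <? θ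
... | yes y<θ = mk⇔ (λ y<x → y<θ) (λ _ → y<x)
              , mk⇔ (λ x<y → ⊥-elim (<-asym x<y y<x)) (λ θ<y → ⊥-elim (<-asym θ<y y<θ))
  where
  y<x : y < x
  y<x = ≤∧≢⇒< (≤-pred (≤-trans y<θ θ≤1+x)) y≢x
... | no  y≮θ = mk⇔ (λ y<x → ⊥-elim (y≮θ (<-≤-trans y<x x≤θ))) (λ θ<y → ⊥-elim (<-asym θ<y θ<1+y))
              , mk⇔ (λ _ → θ<1+y) (λ _ → ≤∧≢⇒< (≤-trans x≤θ (≮⇒≥ y≮θ)) (y≢x ∘ sym))
  where
  θ<1+y : θ < suc y
  θ<1+y = s≤s (≮⇒≥ y≮θ)

IsPerm-∷-punchInℕ : {v : Vec ℕ n} (θ : ℕ) → IsPerm v → 1 ≤ θ → θ ≤ suc n →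
                    IsPerm (θ ∷ map (punchInℕ θ) v)
IsPerm-∷-punchInℕ {n} {v} θ (range , inj) 1≤θ θ≤1+n = range′ , inj′
  where
  lookup-punched : ∀ i → lookup (map (punchInℕ θ) v) i ≡ punchInℕ θ (lookup v i)
  lookup-punched i = lookup-map i (punchInℕ θ) v
  range′ : ∀ i → 1 ≤ lookup (θ ∷ map (punchInℕ θ) v) i × lookup (θ ∷ map (punchInℕ θ) v) i ≤ suc n
  range′ zero    = 1≤θ , θ≤1+n
  range′ (suc i) = subst (λ x → 1 ≤ x × x ≤ suc n) (sym (lookup-punched i)) (punchInℕ-range θ (range i))
  inj′ : ∀ i j → lookup (θ ∷ map (punchInℕ θ) v) i ≡ lookup (θ ∷ map (punchInℕ θ) v) j → i ≡ j
  inj′ zero    zero    _  = refl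
  inj′ zero    (suc j) eq = ⊥-elim (punchInℕ-≢ θ (lookup v j) (sym (trans eq (lookup-punched j))))
  inj′ (suc i) zero    eq = ⊥-elim (punchInℕ-≢ θ (lookup v i) (trans (sym (lookup-punched i)) eq))
  inj′ (suc i) (suc j) eq = cong suc (inj i j (punchInℕ-injective θ
    (trans (sym (lookup-punched i)) (trans eq (lookup-punched j)))))

≅-map-punchInℕ : (θ : ℕ) (v : Vec ℕ n) → lookup v ≅ lookup (map (punchInℕ θ) v)
≅-map-punchInℕ θ v = ≅-resp-≗ (λ _ → refl) (λ i → sym (lookup-map i (punchInℕ θ) v))
                              (≅-sym (strictMono⇒∘-≅ (punchInℕ-mono θ) (lookup v)))

-- σ (θ ∷ map f a) is the sequence f a₁ ⋯ f aₙ θ.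
punchInℕ-edge : {x : ℕ} {xs : Vec ℕ n} (θ : ℕ) → IsPerm (x ∷ xs) → x ≤ θ → θ ≤ suc x →
                IsEdge (σ (θ ∷ map (punchInℕ θ) (x ∷ xs))) (x ∷ xs) (σ (x ∷ xs))
punchInℕ-edge {n} {x} {xs} θ pa x≤θ θ≤1+x =
  IsPerm-σ {v = θ ∷ map f a} (IsPerm-∷-punchInℕ θ pa (≤-trans 1≤x x≤θ) (≤-trans θ≤1+x (s≤s x≤1+n))) ,
  subst (λ d → IsSt d a) (sym (init-∷ʳ θ (map f a))) (pa , ≅-map-punchInℕ θ a) ,
  (IsPerm-σ {v = a} pa , σ-cong-≅ {v = a} {θ ∷ map f xs} (≅-by-head (≅-map-punchInℕ θ xs) below above))
  where
  a : Vec ℕ (suc n)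
  a = x ∷ xs
  f : ℕ → ℕ
  f = punchInℕ θ
  1≤x : 1 ≤ x
  1≤x = proj₁ (proj₁ pa zero)
  x≤1+n : x ≤ suc n
  x≤1+n = proj₂ (proj₁ pa zero)
  same-side : ∀ j → ((lookup xs j < x) ⇔ (lookup (map f xs) j < θ)) ×
                    ((x < lookup xs j) ⇔ (θ < lookup (map f xs) j))
  same-side j with lookup (map f xs) j | lookup-map j f xs
  ... | _ | refl = punchInℕ-same-side x≤θ θ≤1+x (λ eq → 0≢1+n (proj₂ pa zero (suc j) (sym eq)))
  below : ∀ j → (lookup xs j < x) ⇔ (lookup (map f xs) j < θ)
  below = proj₁ ∘ same-side
  above : ∀ j → (x < lookup xs j) ⇔ (θ < lookup (map f xs) j)
  above = proj₂ ∘ same-side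

σ-two-edges : {a : Vec ℕ (suc n)} → IsPerm a → TwoEdges a (σ a)
σ-two-edges {a = x ∷ xs} pa =
  σ (x ∷ map (punchInℕ x) (x ∷ xs)) , σ (suc x ∷ map (punchInℕ (suc x)) (x ∷ xs)) ,
  punchInℕ-edge x pa ≤-refl (n≤1+n x) , punchInℕ-edge (suc x) pa (n≤1+n x) ≤-refl ,
  λ eq → <⇒≢ ≤-refl (∷ʳ-injectiveʳ (map (punchInℕ x) (x ∷ xs)) (map (punchInℕ (suc x)) (x ∷ xs)) eq)

lemma3p13 : (n : ℕ) → 2 ≤ n → (a b : Vec ℕ n) → IsPerm a → IsPerm b →
            TwoEdges a b ⇔ (b ≡ σ a)
lemma3p13 zero    ()
lemma3p13 (suc n) _ a b pa _ = mk⇔ (two-edges⇒σ {a = a}) (λ { refl → σ-two-edges {a = a} pa })
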